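{- Let $n$ be a positive integer with decimal expansion $d_1 d_2 \ldots d_k$ (so $d_1 \neq 0$), and let $M_1(n)$ denote the largest number that can be obtained from $n$ by one Choix de Bruxelles operation. If every digit satisfies $d_i < 5$, then $M_1(n) = 2n$. Otherwise, let $p$ be the largest index with $d_p \ge 5$; then $M_1(n)$ is the number obtained by doubling the substring $d_p d_{p+1}\ldots d_k$, i.e. $M_1(n)$ is the number whose decimal expansion is $d_1 \ldots d_{p-1}$ followed by the decimal expansion of $2\cdot(d_p d_{p+1}\ldots d_k)$.
   Context: The Choix de Bruxelles operation: given a positive integer $n$ with decimal expansion $d_1 d_2 \ldots d_k$, choose indices $1 \le p \le q \le k$ with $d_p \neq 0$, let $s$ be the number with decimal representation $d_p d_{p+1}\ldots d_q$, and replace this substring in situ by the decimal expansion of $2s$, or, if $s$ is even, by the decimal expansion of $s/2$. One may also leave $n$ unchanged (empty substring). For example, $16$ can become any of $16, 26, 13, 112, 8, 32$. -}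

module Defs where

open import Data.Nat using (ℕ; zero; suc; _+_; _*_; _<_; _≤_)
open import Data.Nat.Divisibility using (_∣_)
open import Data.Nat.DivMod using (_/_)
open import Data.List using (List; []; _∷_; _++_; foldl)
open import Data.List.Relation.Unary.All using (All)
open import Data.Product using (Σ; _×_; ∃)
open import Data.Sum using (_⊎_)
open import Relation.Binary.PropositionalEquality using (_≡_; _≢_)

val : List ℕ → ℕ
val = foldl (λ acc d → 10 * acc + d) 0

data IsDecExp : List ℕ → ℕ → Set where
  decExp : ∀ (d : ℕ) (ds : List ℕ) → d ≢ 0 → All (_< 10) (d ∷ ds) →
           IsDecExp (d ∷ ds) (val (d ∷ ds))

-- Either the empty substring (m = n), or: write the decimal expansion of n
-- as xs ++ ys ++ zs with ys = d_p ... d_q nonempty and d_p ≠ 0, s = val ys,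
-- t = 2s or (s even and t = s/2), and replace ys in situ by the decimal
-- expansion es of t.
data Bruxelles (n : ℕ) : ℕ → Set where
  unchanged : Bruxelles n n
  replace : ∀ (xs : List ℕ) (d : ℕ) (ys zs es : List ℕ) (t : ℕ) →
            IsDecExp (xs ++ (d ∷ ys) ++ zs) n →
            d ≢ 0 →
            (t ≡ 2 * val (d ∷ ys) ⊎ (2 ∣ val (d ∷ ys) × t ≡ val (d ∷ ys) / 2)) →
            IsDecExp es t →
            Bruxelles n (val (xs ++ es ++ zs))

IsM₁ : ℕ → ℕ → Set
IsM₁ n M = Bruxelles n M × (∀ m → Bruxelles n m → m ≤ M)

{-# OPTIONS --safe #-}
-- Any operation replaces a block s of L digits by a block t of e digits. If e ≤ L the result is
-- at most 2n. If e > L then t = 2s, e = L + 1 and the leading digit of s is at least 5, so the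
-- result is at most the number obtained by doubling the whole suffix ws starting at that digit,
-- val xs · 10^(|ws| + 1) + 2 · val ws. This bound grows as the starting digit moves right and it
-- dominates 2n; hence the maximum is attained by doubling the suffix at the last digit ≥ 5, or,
-- when there is no such digit, by doubling n itself.
module Submission where

open import Defs
open import Data.Nat
open import Data.Nat.Properties
open import Data.Nat.Divisibility using (_∣_)
open import Data.Nat.DivMod using (_/_; m/n≤m)
open import Data.Nat.Tactic.RingSolver using (solve-∀)
open import Data.List using (List; []; _∷_; _++_; [_]; foldl; length; map)
open import Data.List.Properties
  using (foldl-++; length-++; length-map; ++-identityʳ; ∷-injective; ∷-injectiveʳ)
open import Data.List.Relation.Unary.All as All using (All; []; _∷_)
open import Data.List.Relation.Unary.All.Properties using (++⁻ˡ; ++⁻ʳ; map⁺)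
open import Data.Product using (∃; _×_; _,_)
open import Data.Sum using (_⊎_; inj₁; inj₂)
open import Relation.Binary using (tri<; tri≈; tri>)
open import Relation.Binary.PropositionalEquality
  using (_≡_; _≢_; refl; sym; trans; cong; cong₂; subst; module ≡-Reasoning)
open import Relation.Nullary using (¬_; yes; no; contradiction)
open import Relation.Unary using (Pred)

^-cancelʳ-< : ∀ m .{{_ : NonZero m}} {a b} → m ^ a < m ^ b → a < b
^-cancelʳ-< m {a} {b} mᵃ<mᵇ with a <? b
... | yes a<b = a<b
... | no a≮b = contradiction (^-monoʳ-≤ m (≮⇒≥ a≮b)) (<⇒≱ mᵃ<mᵇ)

10^a≤m<10^1+b⇒a≤b : ∀ {a b m} → 10 ^ a ≤ m → m < 10 ^ suc b → a ≤ b
10^a≤m<10^1+b⇒a≤b lo hi = s≤s⁻¹ (^-cancelʳ-< 10 (≤-<-trans lo hi))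

2≤10 : 2 ≤ 10
2≤10 = s≤s (s≤s z≤n)

Digits : List ℕ → Set
Digits = All (_< 10)

foldl-val : ∀ acc xs → foldl (λ a d → 10 * a + d) acc xs ≡ acc * 10 ^ length xs + val xs
foldl-val acc [] = sym (trans (+-identityʳ _) (*-identityʳ acc))
foldl-val acc (x ∷ xs) = begin
    foldl _ (10 * acc + x) xs              ≡⟨ foldl-val (10 * acc + x) xs ⟩
    (10 * acc + x) * P + val xs            ≡⟨ shift acc x P (val xs) ⟩
    acc * (10 * P) + (x * P + val xs)      ≡⟨ cong (acc * (10 * P) +_) (foldl-val x xs) ⟨
    acc * (10 * P) + val (x ∷ xs)          ∎
  where
  open ≡-Reasoning
  P = 10 ^ length xs
  shift : ∀ a x P v → (10 * a + x) * P + v ≡ a * (10 * P) + (x * P + v)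
  shift = solve-∀

val-++ : ∀ xs ys → val (xs ++ ys) ≡ val xs * 10 ^ length ys + val ys
val-++ xs ys = trans (foldl-++ _ 0 xs ys) (foldl-val (val xs) ys)

val-∷ : ∀ x xs → val (x ∷ xs) ≡ x * 10 ^ length xs + val xs
val-∷ x = val-++ [ x ]

val-splice : ∀ xs ys zs →
  val (xs ++ ys ++ zs) ≡ val xs * 10 ^ (length ys + length zs) + (val ys * 10 ^ length zs + val zs)
val-splice xs ys zs = trans (val-++ xs (ys ++ zs))
  (cong₂ (λ k v → val xs * 10 ^ k + v) (length-++ ys) (val-++ ys zs))

val-< : ∀ {xs} → Digits xs → val xs < 10 ^ length xs
val-∷-< : ∀ d {xs} → Digits xs → val (d ∷ xs) < suc d * 10 ^ length xs

val-< [] = s≤s z≤n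
val-< {x ∷ xs} (x<10 ∷ dxs) = <-≤-trans (val-∷-< x dxs) (*-monoˡ-≤ (10 ^ length xs) x<10)

val-∷-< d {xs} dxs = begin-strict
    val (d ∷ xs)       ≡⟨ val-∷ d xs ⟩
    d * P + val xs     <⟨ +-monoʳ-< (d * P) (val-< dxs) ⟩
    d * P + P          ≡⟨ +-comm (d * P) P ⟩
    suc d * P          ∎
  where
  open ≤-Reasoning
  P = 10 ^ length xs

val-∷-≥ : ∀ d xs → d * 10 ^ length xs ≤ val (d ∷ xs)
val-∷-≥ d xs = ≤-trans (m≤m+n (d * 10 ^ length xs) (val xs)) (≤-reflexive (sym (val-∷ d xs)))

lead-<⇒val-< : ∀ {x y xs ys} → Digits xs → length xs ≡ length ys → x < y → val (x ∷ xs) < val (y ∷ ys)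
lead-<⇒val-< {x} {y} {xs} {ys} dxs |xs|≡|ys| x<y = begin-strict
    val (x ∷ xs)           <⟨ val-∷-< x dxs ⟩
    suc x * 10 ^ length xs ≤⟨ *-monoˡ-≤ (10 ^ length xs) x<y ⟩
    y * 10 ^ length xs     ≡⟨ cong (λ k → y * 10 ^ k) |xs|≡|ys| ⟩
    y * 10 ^ length ys     ≤⟨ val-∷-≥ y ys ⟩
    val (y ∷ ys)           ∎
  where open ≤-Reasoning

val-injective : ∀ {xs ys} → length xs ≡ length ys → Digits xs → Digits ys → val xs ≡ val ys → xs ≡ ys
val-injective {[]} {[]} _ _ _ _ = refl
val-injective {x ∷ xs} {y ∷ ys} |x∷xs|≡|y∷ys| (_ ∷ dxs) (_ ∷ dys) eq with <-cmp x y
... | tri< x<y _ _ =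
  contradiction eq (<⇒≢ (lead-<⇒val-< {xs = xs} {ys} dxs (suc-injective |x∷xs|≡|y∷ys|) x<y))
... | tri> _ _ y<x =
  contradiction (sym eq) (<⇒≢ (lead-<⇒val-< {xs = ys} {xs} dys (sym (suc-injective |x∷xs|≡|y∷ys|)) y<x))
... | tri≈ _ refl _ = cong (x ∷_) (val-injective |xs|≡|ys| dxs dys (+-cancelˡ-≡ (x * P) _ _ tails))
  where
  open ≡-Reasoning
  |xs|≡|ys| : length xs ≡ length ys
  |xs|≡|ys| = suc-injective |x∷xs|≡|y∷ys|
  P = 10 ^ length xs
  tails : x * P + val xs ≡ x * P + val ys
  tails = begin
    x * P + val xs                 ≡⟨ val-∷ x xs ⟨
    val (x ∷ xs)                   ≡⟨ eq ⟩
    val (x ∷ ys)                   ≡⟨ val-∷ x ys ⟩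
    x * 10 ^ length ys + val ys    ≡⟨ cong (λ k → x * 10 ^ k + val ys) |xs|≡|ys| ⟨
    x * P + val ys                 ∎

decExp-val : ∀ {ds n} → IsDecExp ds n → val ds ≡ n
decExp-val (decExp _ _ _ _) = refl

decExp-digits : ∀ {ds n} → IsDecExp ds n → Digits ds
decExp-digits (decExp _ _ _ dds) = dds

decExp-upper : ∀ {ds n} → IsDecExp ds n → n < 10 ^ length ds
decExp-upper (decExp _ _ _ dds) = val-< dds

decExp-lower : ∀ {d ds n} → IsDecExp (d ∷ ds) n → 10 ^ length ds ≤ n
decExp-lower (decExp d ds d≢0 _) =
  ≤-trans (m≤n*m (10 ^ length ds) d {{≢-nonZero d≢0}}) (val-∷-≥ d ds)

decExp-length : ∀ {es t k} → IsDecExp es t → 10 ^ k ≤ t → t < 10 ^ suc k → length es ≡ suc k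
decExp-length h@(decExp _ _ _ _) lo hi =
  cong suc (≤-antisym (10^a≤m<10^1+b⇒a≤b (decExp-lower h) hi)
                      (10^a≤m<10^1+b⇒a≤b lo (decExp-upper h)))

decExp-long⇒≥ : ∀ {es t k} → IsDecExp es t → k < length es → 10 ^ k ≤ t
decExp-long⇒≥ h@(decExp _ ds _ _) (s≤s k≤|ds|) = ≤-trans (^-monoʳ-≤ 10 k≤|ds|) (decExp-lower h)

decExp-unique : ∀ {ds es n} → IsDecExp ds n → IsDecExp es n → ds ≡ es
decExp-unique h@(decExp _ _ _ dds) h' =
  val-injective (sym (decExp-length h' (decExp-lower h) (decExp-upper h))) dds (decExp-digits h')
    (sym (decExp-val h'))

DoublingCarries : List ℕ → Set
DoublingCarries ws = 10 ^ length ws ≤ 2 * val ws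

double-val-< : ∀ {ws} → Digits ws → 2 * val ws < 10 ^ suc (length ws)
double-val-< {ws} dws = <-≤-trans (*-monoʳ-< 2 (val-< dws)) (*-monoˡ-≤ (10 ^ length ws) 2≤10)

5≤d⇒doublingCarries : ∀ {d} ys → 5 ≤ d → DoublingCarries (d ∷ ys)
5≤d⇒doublingCarries {d} ys 5≤d = begin
    10 * P              ≡⟨ *-assoc 2 5 P ⟩
    2 * (5 * P)         ≤⟨ *-monoʳ-≤ 2 (≤-trans (*-monoˡ-≤ P 5≤d) (val-∷-≥ d ys)) ⟩
    2 * val (d ∷ ys)    ∎
  where
  open ≤-Reasoning
  P = 10 ^ length ys

doublingCarries⇒5≤d : ∀ {d ys} → Digits ys → DoublingCarries (d ∷ ys) → 5 ≤ d
doublingCarries⇒5≤d {d} {ys} dys carries =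
  s≤s⁻¹ (*-cancelˡ-< 2 5 (suc d) (*-cancelʳ-< P 10 (2 * suc d) 10P<2[1+d]P))
  where
  open ≤-Reasoning
  P = 10 ^ length ys
  10P<2[1+d]P : 10 * P < 2 * suc d * P
  10P<2[1+d]P = begin-strict
    10 * P              ≤⟨ carries ⟩
    2 * val (d ∷ ys)    <⟨ *-monoʳ-< 2 (val-∷-< d dys) ⟩
    2 * (suc d * P)     ≡⟨ *-assoc 2 (suc d) P ⟨
    2 * suc d * P       ∎

Rescaling : ℕ → ℕ → Set
Rescaling s t = t ≡ 2 * s ⊎ (2 ∣ s × t ≡ s / 2)

rescaling-≤-double : ∀ {s t} → Rescaling s t → t ≤ 2 * s
rescaling-≤-double {s} (inj₁ t≡2s) = ≤-reflexive t≡2s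
rescaling-≤-double {s} (inj₂ (_ , t≡s/2)) = ≤-trans (≤-reflexive t≡s/2) (≤-trans (m/n≤m s 2) (m≤n*m s 2))

lengthening-rescaling : ∀ {d ys es t} → Digits (d ∷ ys) → Rescaling (val (d ∷ ys)) t → IsDecExp es t →
  length (d ∷ ys) < length es →
  t ≡ 2 * val (d ∷ ys) × length es ≡ suc (length (d ∷ ys)) × 5 ≤ d
lengthening-rescaling {d} {ys} {t = t} dV@(_ ∷ dys) (inj₁ t≡2s) he longer =
  t≡2s , decExp-length he 10^L≤t (subst (_< _) (sym t≡2s) (double-val-< dV)) ,
  doublingCarries⇒5≤d dys (subst (_ ≤_) t≡2s 10^L≤t)
  where
  10^L≤t : 10 ^ length (d ∷ ys) ≤ t
  10^L≤t = decExp-long⇒≥ he longer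
lengthening-rescaling {d} {ys} {t = t} dV (inj₂ (_ , t≡s/2)) he longer =
  contradiction (≤-<-trans t≤s (val-< dV)) (≤⇒≯ (decExp-long⇒≥ he longer))
  where
  t≤s : t ≤ val (d ∷ ys)
  t≤s = ≤-trans (≤-reflexive t≡s/2) (m/n≤m (val (d ∷ ys)) 2)

splice-≤-double : ∀ xs {ys es} zs → length es ≤ length ys → val es ≤ 2 * val ys →
  val (xs ++ es ++ zs) ≤ 2 * val (xs ++ ys ++ zs)
splice-≤-double xs {ys} {es} zs |es|≤|ys| es≤2ys = begin
    val (xs ++ es ++ zs)                        ≡⟨ val-splice xs es zs ⟩
    X * 10 ^ (length es + c) + (val es * C + Z)
      ≤⟨ +-mono-≤ (*-monoʳ-≤ X (^-monoʳ-≤ 10 (+-monoˡ-≤ c |es|≤|ys|))) (+-monoˡ-≤ Z (*-monoˡ-≤ C es≤2ys)) ⟩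
    A + (2 * val ys * C + Z)                    ≤⟨ m≤m+n _ (A + Z) ⟩
    A + (2 * val ys * C + Z) + (A + Z)          ≡⟨ regroup A (val ys) C Z ⟩
    2 * (A + (val ys * C + Z))                  ≡⟨ cong (2 *_) (val-splice xs ys zs) ⟨
    2 * val (xs ++ ys ++ zs)                    ∎
  where
  open ≤-Reasoning
  X = val xs
  Z = val zs
  c = length zs
  C = 10 ^ c
  A = X * 10 ^ (length ys + c)
  regroup : ∀ a s C z → a + (2 * s * C + z) + (a + z) ≡ 2 * (a + (s * C + z))
  regroup = solve-∀

-- The value of xs ++ ws after doubling the block ws, provided the doubled block has one digit more than ws.
carryDouble : List ℕ → List ℕ → ℕ
carryDouble xs ws = val xs * 10 ^ suc (length ws) + 2 * val ws

splice-≤-carryDouble : ∀ xs {ys es} zs → length es ≡ suc (length ys) → val es ≡ 2 * val ys →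
  val (xs ++ es ++ zs) ≤ carryDouble xs (ys ++ zs)
splice-≤-carryDouble xs {ys} {es} zs |es|≡1+|ys| es≡2ys = begin
    val (xs ++ es ++ zs)                           ≡⟨ val-splice xs es zs ⟩
    X * 10 ^ (length es + c) + (val es * C + Z)
      ≡⟨ cong₂ (λ k v → X * 10 ^ (k + c) + (v * C + Z)) |es|≡1+|ys| es≡2ys ⟩
    X * 10 ^ suc (length ys + c) + (2 * val ys * C + Z)
      ≤⟨ +-monoʳ-≤ (X * 10 ^ suc (length ys + c)) (+-mono-≤ (≤-reflexive (*-assoc 2 (val ys) C)) (m≤n*m Z 2)) ⟩
    X * 10 ^ suc (length ys + c) + (2 * (val ys * C) + 2 * Z)
      ≡⟨ cong (X * 10 ^ suc (length ys + c) +_) (*-distribˡ-+ 2 (val ys * C) Z) ⟨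
    X * 10 ^ suc (length ys + c) + 2 * (val ys * C + Z)
      ≡⟨ cong₂ (λ k v → X * 10 ^ suc k + 2 * v) (length-++ ys) (val-++ ys zs) ⟨
    carryDouble xs (ys ++ zs)                      ∎
  where
  open ≤-Reasoning
  X = val xs
  Z = val zs
  c = length zs
  C = 10 ^ c

double≤carryDouble : ∀ xs ws → 2 * val (xs ++ ws) ≤ carryDouble xs ws
double≤carryDouble xs ws = begin
    2 * val (xs ++ ws)          ≡⟨ cong (2 *_) (val-++ xs ws) ⟩
    2 * (X * P + W)             ≡⟨ *-distribˡ-+ 2 (X * P) W ⟩
    2 * (X * P) + 2 * W         ≤⟨ +-monoˡ-≤ (2 * W) (*-monoˡ-≤ (X * P) 2≤10) ⟩
    10 * (X * P) + 2 * W        ≡⟨ cong (_+ 2 * W) (left-comm 10 X P) ⟩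
    X * (10 * P) + 2 * W        ∎
  where
  open ≤-Reasoning
  X = val xs
  W = val ws
  P = 10 ^ length ws
  left-comm : ∀ a b c → a * (b * c) ≡ b * (a * c)
  left-comm = solve-∀

carryDouble-mono : ∀ xs qs ws → carryDouble xs (qs ++ ws) ≤ carryDouble (xs ++ qs) ws
carryDouble-mono xs qs ws = begin
    carryDouble xs (qs ++ ws)
      ≡⟨ cong₂ (λ k v → X * 10 ^ suc k + 2 * v) (length-++ qs) (val-++ qs ws) ⟩
    X * (10 * 10 ^ (length qs + length ws)) + 2 * (Q * B + W)
      ≡⟨ cong (λ p → X * (10 * p) + 2 * (Q * B + W)) (^-distribˡ-+-* 10 (length qs) (length ws)) ⟩
    X * (10 * (A * B)) + 2 * (Q * B + W)     ≡⟨ expand X Q W A B ⟩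
    10 * (X * A * B) + 2 * (Q * B) + 2 * W
      ≤⟨ +-monoˡ-≤ (2 * W) (+-monoʳ-≤ (10 * (X * A * B)) (*-monoˡ-≤ (Q * B) 2≤10)) ⟩
    10 * (X * A * B) + 10 * (Q * B) + 2 * W  ≡⟨ collect X Q W A B ⟩
    (X * A + Q) * (10 * B) + 2 * W           ≡⟨ cong (λ v → v * (10 * B) + 2 * W) (val-++ xs qs) ⟨
    carryDouble (xs ++ qs) ws                ∎
  where
  open ≤-Reasoning
  X = val xs
  Q = val qs
  W = val ws
  A = 10 ^ length qs
  B = 10 ^ length ws
  expand : ∀ X Q W A B → X * (10 * (A * B)) + 2 * (Q * B + W) ≡ 10 * (X * A * B) + 2 * (Q * B) + 2 * W
  expand = solve-∀
  collect : ∀ X Q W A B → 10 * (X * A * B) + 10 * (Q * B) + 2 * W ≡ (X * A + Q) * (10 * B) + 2 * W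
  collect = solve-∀

++-∷-split-prefix : ∀ {a p} {A : Set a} {P : Pred A p} xs′ xs {w y : A} {ws ys} →
  xs′ ++ w ∷ ws ≡ xs ++ y ∷ ys → ¬ P w → All P ys →
  ∃ λ qs → xs ≡ xs′ ++ qs × w ∷ ws ≡ qs ++ y ∷ ys
++-∷-split-prefix [] xs eq _ _ = xs , refl , eq
++-∷-split-prefix {P = P} (_ ∷ xs′) [] eq ¬Pw Pys =
  contradiction (All.head (++⁻ʳ xs′ (subst (All P) (sym (∷-injectiveʳ eq)) Pys))) ¬Pw
++-∷-split-prefix (_ ∷ xs′) (_ ∷ xs) eq ¬Pw Pys with ∷-injective eq
... | refl , eq′ with ++-∷-split-prefix xs′ xs eq′ ¬Pw Pys
...   | qs , refl , split = qs , refl , split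

double-suffix : ∀ {n} xs {d ys es} → IsDecExp (xs ++ d ∷ ys) n → d ≢ 0 → IsDecExp es (2 * val (d ∷ ys)) →
  Bruxelles n (val (xs ++ es))
double-suffix {n} xs {d} {ys} {es} hn d≢0 he =
  subst (λ zs → Bruxelles _ (val (xs ++ zs))) (++-identityʳ es)
    (replace xs d ys [] es _ hn′ d≢0 (inj₁ refl) he)
  where
  hn′ : IsDecExp (xs ++ (d ∷ ys) ++ []) n
  hn′ = subst (λ zs → IsDecExp (xs ++ d ∷ zs) n) (sym (++-identityʳ ys)) hn

CarryBounded : List ℕ → ℕ → Set
CarryBounded ds m = ∃ λ xs → ∃ λ d → ∃ λ ws → ds ≡ xs ++ d ∷ ws × 5 ≤ d × m ≤ carryDouble xs (d ∷ ws)

bruxelles-bound : ∀ {ds n m} → IsDecExp ds n → Bruxelles n m → m ≤ 2 * n ⊎ CarryBounded ds m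
bruxelles-bound {n = n} _ unchanged = inj₁ (m≤n*m n 2)
bruxelles-bound hd (replace xs d ys zs es t hn _ r he) with length es ≤? length (d ∷ ys)
... | yes shorter =
  inj₁ (subst (λ k → _ ≤ 2 * k) (decExp-val hn)
          (splice-≤-double xs zs shorter (subst (_≤ _) (sym (decExp-val he)) (rescaling-≤-double r))))
... | no longer with lengthening-rescaling (++⁻ˡ (d ∷ ys) (++⁻ʳ xs (decExp-digits hn))) r he (≰⇒> longer)
...   | t≡2s , |es|≡1+|ys| , 5≤d =
  inj₂ (xs , d , ys ++ zs , decExp-unique hd hn , 5≤d ,
        splice-≤-carryDouble xs {d ∷ ys} zs |es|≡1+|ys| (trans (decExp-val he) t≡2s))

bruxelles-≤-carryDouble : ∀ {n} xs {d ys m} → IsDecExp (xs ++ d ∷ ys) n → All (_< 5) ys → Bruxelles n m →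
  m ≤ carryDouble xs (d ∷ ys)
bruxelles-≤-carryDouble xs {d} {ys} hn small op with bruxelles-bound hn op
... | inj₁ m≤2n = ≤-trans m≤2n (subst (λ k → 2 * k ≤ _) (decExp-val hn) (double≤carryDouble xs (d ∷ ys)))
... | inj₂ (xs′ , d′ , ws , eq , 5≤d′ , m≤) with ++-∷-split-prefix xs′ xs (sym eq) (≤⇒≯ 5≤d′) small
...   | qs , refl , split = begin
    _                                  ≤⟨ m≤ ⟩
    carryDouble xs′ (d′ ∷ ws)          ≡⟨ cong (carryDouble xs′) split ⟩
    carryDouble xs′ (qs ++ d ∷ ys)     ≤⟨ carryDouble-mono xs′ qs (d ∷ ys) ⟩
    carryDouble (xs′ ++ qs) (d ∷ ys)   ∎
  where open ≤-Reasoning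

val-map-double : ∀ xs → val (map (2 *_) xs) ≡ 2 * val xs
val-map-double [] = refl
val-map-double (x ∷ xs) = begin
    val (map (2 *_) (x ∷ xs))                         ≡⟨ val-∷ (2 * x) (map (2 *_) xs) ⟩
    2 * x * 10 ^ length (map (2 *_) xs) + val (map (2 *_) xs)
      ≡⟨ cong₂ (λ k v → 2 * x * 10 ^ k + v) (length-map (2 *_) xs) (val-map-double xs) ⟩
    2 * x * P + 2 * val xs                            ≡⟨ cong (_+ 2 * val xs) (*-assoc 2 x P) ⟩
    2 * (x * P) + 2 * val xs                          ≡⟨ *-distribˡ-+ 2 (x * P) (val xs) ⟨
    2 * (x * P + val xs)                              ≡⟨ cong (2 *_) (val-∷ x xs) ⟨
    2 * val (x ∷ xs)                                  ∎
  where
  open ≡-Reasoning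
  P = 10 ^ length xs

double-decExp : ∀ {ds n} → IsDecExp ds n → All (_< 5) ds → IsDecExp (map (2 *_) ds) (2 * n)
double-decExp (decExp d ds d≢0 _) small =
  subst (IsDecExp _) (val-map-double (d ∷ ds))
    (decExp (2 * d) (map (2 *_) ds) (m<n⇒n≢0 (*-monoʳ-< 2 (n≢0⇒n>0 d≢0)))
            (map⁺ (All.map (*-monoʳ-< 2) small)))

M₁-small-digits : ∀ {ds n} → IsDecExp ds n → All (_< 5) ds → IsM₁ n (2 * n)
M₁-small-digits {n = n} hd@(decExp d ds d≢0 _) small =
  subst (Bruxelles n) (decExp-val h2n) (double-suffix [] hd d≢0 h2n) , bound
  where
  h2n : IsDecExp (map (2 *_) (d ∷ ds)) (2 * n)
  h2n = double-decExp hd small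
  bound : ∀ m → Bruxelles n m → m ≤ 2 * n
  bound m op with bruxelles-bound hd op
  ... | inj₁ m≤2n = m≤2n
  ... | inj₂ (xs , _ , _ , eq , 5≤d′ , _) =
    contradiction (All.head (++⁻ʳ xs (subst (All (_< 5)) eq small))) (≤⇒≯ 5≤d′)

M₁-last-large-digit : ∀ {n} xs {d ys es} → IsDecExp (xs ++ d ∷ ys) n → 5 ≤ d → All (_< 5) ys →
  IsDecExp es (2 * val (d ∷ ys)) → IsM₁ n (val (xs ++ es))
M₁-last-large-digit xs {d} {ys} {es} hn 5≤d small he =
  double-suffix xs hn (m<n⇒n≢0 5≤d) he ,
  λ m op → subst (m ≤_) (sym M≡carryDouble) (bruxelles-≤-carryDouble xs hn small op)
  where
  M≡carryDouble : val (xs ++ es) ≡ carryDouble xs (d ∷ ys)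
  M≡carryDouble = trans (val-++ xs es)
    (cong₂ (λ k v → val xs * 10 ^ k + v)
      (decExp-length {k = length (d ∷ ys)} he (5≤d⇒doublingCarries ys 5≤d)
                     (double-val-< (++⁻ʳ xs (decExp-digits hn))))
      (decExp-val he))

theorem1 : ∀ (n : ℕ) (ds : List ℕ) → IsDecExp ds n →
    (All (_< 5) ds → IsM₁ n (2 * n)) ×
    (∀ (xs : List ℕ) (d : ℕ) (ys : List ℕ) → ds ≡ xs ++ (d ∷ ys) → 5 ≤ d → All (_< 5) ys →
      ∀ (es : List ℕ) → IsDecExp es (2 * val (d ∷ ys)) →
      IsM₁ n (val (xs ++ es)))
theorem1 n ds hd =
  M₁-small-digits hd ,
  λ xs d ys ds≡xs++d∷ys 5≤d small es he →
    M₁-last-large-digit xs (subst (λ zs → IsDecExp zs n) ds≡xs++d∷ys hd) 5≤d small he
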